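{- Let $a,k$ be positive integers and let $T=T\big(a,a+1,\ldots,a+k,(a+\tfrac k2)(k+1)\big)$. Set $h=(k-1)(2a+k)+2a-1$ and for $p\in\{1,\ldots,a+k\}$ let $$D_p=\begin{cases}\{ph+p(p-1)+2pi:\ i\in\{1,\ldots,k+1\}\}, & p\in\{1,\ldots,a\},\\ \{ph+p(p-1)+2pi:\ i\in\{1,\ldots,(k+1)-(p-a)\}\}, & p\in\{a+1,\ldots,a+k\},\end{cases}$$ and $D=\bigcup_{p=1}^{a+k}D_p$. If no $d\in D$ is a perfect square lying in the interval $\big[k(2a+k-1)+1,\ (a+\tfrac k2)^2(k+1)^2\big]$, then $T$ is transmission irregular.
   Context: The transmission of a vertex $v$ of a graph $G$ is ${\rm Tr}_G(v)=\sum_{u\in V(G)} d_G(u,v)$; $G$ is transmission irregular if all its vertices have pairwise different transmissions. For $t\ge3$ and positive integers $k_1,\ldots,k_t$, the starlike tree $T(k_1,\ldots,k_t)$ is the tree obtained by attaching to a single vertex $t$ pendant paths of lengths $k_1,\ldots,k_t$. Note $(a+\frac k2)(k+1)=a+(a+1)+\cdots+(a+k)$ is an integer. -}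

module Defs where

open import Data.Bool using (Bool; true; false; _∧_; _∨_; if_then_else_)
open import Data.Nat using (ℕ; zero; suc; _+_; _*_; _∸_; _≡ᵇ_; _<ᵇ_)
open import Data.Fin using (Fin; toℕ)
open import Data.List using (List; []; _∷_; _++_; map; upTo; allFin)
open import Data.Bool.ListAction using (any)
open import Data.Nat.ListAction using (sum)
open import Data.Product using (_×_; _,_)
open import Function.Definitions using (Injective)
open import Relation.Binary.PropositionalEquality using (_≡_)

-- A finite simple graph on vertex set Fin order, given by a Boolean
-- adjacency relation (symmetric, irreflexive for the graphs we build).
record Graph : Set where
  field
    order : ℕ
    adj   : Fin order → Fin order → Bool
open Graph public

reach : (G : Graph) → ℕ → Fin (order G) → Fin (order G) → Bool
reach G zero    u v = toℕ u ≡ᵇ toℕ v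
reach G (suc m) u v =
  reach G m u v ∨ any (λ w → adj G u w ∧ reach G m w v) (allFin (order G))

-- least m < n with f m = true, or n if there is none.
leastBelow : (ℕ → Bool) → ℕ → ℕ
leastBelow f zero    = zero
leastBelow f (suc n) =
  if leastBelow f n <ᵇ n then leastBelow f n
  else (if f n then n else suc n)

-- Shortest paths have length < order G; in a connected graph such as a tree
-- this is the usual distance (for disconnected pairs the value is order G,
-- which never arises below).
dist : (G : Graph) → Fin (order G) → Fin (order G) → ℕ
dist G u v = leastBelow (λ m → reach G m u v) (order G)

Tr : (G : Graph) → Fin (order G) → ℕ
Tr G v = sum (map (λ u → dist G u v) (allFin (order G)))

TransmissionIrregular : Graph → Set
TransmissionIrregular G = Injective _≡_ _≡_ (Tr G)

-- Vertex 0 is the centre; the i-th pendant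
-- path (length k_i) occupies the vertices s+1,…,s+k_i in order, where
-- s = k₁+…+k_{i-1}; vertex s+1 is adjacent to the centre.
legEdges : ℕ → ℕ → List (ℕ × ℕ)
legEdges s k = map edge (upTo k)
  where
  edge : ℕ → ℕ × ℕ
  edge zero    = (0 , s + 1)
  edge (suc j) = (s + suc j , s + suc j + 1)

starEdges : ℕ → List ℕ → List (ℕ × ℕ)
starEdges s []       = []
starEdges s (k ∷ ks) = legEdges s k ++ starEdges (s + k) ks

edgeAdj : List (ℕ × ℕ) → ℕ → ℕ → Bool
edgeAdj es u v = any (λ { (x , y) → ((x ≡ᵇ u) ∧ (y ≡ᵇ v)) ∨ ((x ≡ᵇ v) ∧ (y ≡ᵇ u)) }) es

starlike : List ℕ → Graph
starlike ks = record
  { order = suc (sum ks)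
  ; adj   = λ u v → edgeAdj (starEdges 0 ks) (toℕ u) (toℕ v) }

consecutive : ℕ → ℕ → List ℕ
consecutive a k = map (λ j → a + j) (upTo (suc k))

-- (a + k/2)(k+1) = a + (a+1) + … + (a+k), written as (2a+k)(k+1)/2
-- computed exactly as a sum.
bigLeg : ℕ → ℕ → ℕ
bigLeg a k = sum (consecutive a k)

T : ℕ → ℕ → Graph
T a k = starlike (consecutive a k ++ (bigLeg a k ∷ []))

hh : ℕ → ℕ → ℕ
hh a k = (k ∸ 1) * (2 * a + k) + 2 * a ∸ 1

iBound : ℕ → ℕ → ℕ → ℕ
iBound a k p = if p Data.Nat.≤ᵇ a then k + 1 else (k + 1) ∸ (p ∸ a)

InD : ℕ → ℕ → ℕ → Set
InD a k d = Data.Product.∃ λ p → Data.Product.∃ λ i →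
  (1 Data.Nat.≤ p) × (p Data.Nat.≤ a + k) ×
  (1 Data.Nat.≤ i) × (i Data.Nat.≤ iBound a k p) ×
  (d ≡ p * hh a k + p * (p ∸ 1) + 2 * p * i)

module Submission where

-- Label the vertices of a starlike tree with leg lengths ks as in Defs: the
-- centre is 0 and each leg is a block of consecutive labels.  For a vertex i
-- write start i for the label just before its leg, legLen i for the length of
-- its leg and depth i = i ∸ start i for its distance to the centre.
--
--  1. Any function on vertex pairs that vanishes exactly on the diagonal, is
--     1-Lipschitz along edges and can always be decreased by stepping to a
--     neighbour equals the distance dist of Defs (path-metric characterisation).
--  2. For a starlike tree, |depth i - depth j| (same leg) and depth i + depth j
--     (different legs) is such a function, so it is the distance.
--  3. Moving one step outwards along a leg changes the transmission by
--     (N+1) − 2·(vertices at or beyond the new vertex), N = Σ ks.  Summing the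
--     steps gives the transmission formula, for x = depth v and K = legLen v:
--         Tr v + x·2K = Tr 0 + x·(N + x).
--  4. For T(a,…,a+k,B) we have N = 2B.  Equal transmissions of two vertices
--     then give a quadratic identity between depths and leg lengths, which is
--     impossible for the centre, forces equality on a common leg, is refuted
--     by a polynomial identity for two short legs, and for a short and the
--     long leg exhibits an element of D that is a square in the forbidden
--     interval — excluded by the hypothesis of the theorem.

open import Defs
open import Data.Bool using (Bool; true; false) renaming (T to IsTrue)
open import Data.Bool.Properties using (T-∨; T-∧)
open import Data.Empty using (⊥; ⊥-elim)
open import Data.Fin using (Fin; toℕ; fromℕ<)
open import Data.Fin.Properties using (toℕ-injective; toℕ<n; toℕ-fromℕ<)
open import Data.List using (List; []; _∷_; _++_; map; upTo; applyUpTo; allFin; tabulate)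
open import Data.List.Properties using (map-tabulate; map-cong; map-++; upTo-∷ʳ; map-upTo)
open import Data.List.Membership.Propositional using (_∈_; lose; find)
open import Data.List.Membership.Propositional.Properties
  using (∈-allFin; ∈-map⁺; ∈-map⁻; ∈-++⁺ˡ; ∈-++⁺ʳ; ∈-++⁻; ∈-upTo⁺; ∈-upTo⁻)
open import Data.List.Relation.Unary.All using (All; []; _∷_)
import Data.List.Relation.Unary.All as All
open import Data.List.Relation.Unary.All.Properties using (applyUpTo⁺₁; ++⁺)
open import Data.List.Relation.Unary.Any using (here; there)
open import Data.List.Relation.Unary.Any.Properties using (any⁺; any⁻)
open import Data.Nat using (ℕ; zero; suc; pred; >-nonZero; _+_; _*_; _∸_; _≤_; _<_; _≤ᵇ_; _<ᵇ_; _⊓_; ∣_-_∣; z≤n; s≤s)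
open import Data.Nat.Properties
open import Data.Nat.ListAction using (sum)
open import Data.Nat.ListAction.Properties using (sum-++)
open import Data.Nat.Tactic.RingSolver using (solve-∀)
open import Data.Product using (Σ; _×_; _,_; proj₁; proj₂)
open import Data.Sum using (_⊎_; inj₁; inj₂)
open import Data.Unit using (⊤; tt)
open import Function using (_∘_)
open import Function.Bundles using (Equivalence)
open import Relation.Binary using (tri<; tri≈; tri>)
open import Relation.Binary.PropositionalEquality
open import Relation.Nullary using (¬_; Dec; yes; no)
open import Relation.Nullary.Decidable using (_×-dec_)

T⇒≡true : ∀ {b} → IsTrue b → b ≡ true
T⇒≡true {true} _ = refl

¬T⇒≡false : ∀ {b} → ¬ IsTrue b → b ≡ false
¬T⇒≡false {true}  f = ⊥-elim (f tt)
¬T⇒≡false {false} _ = refl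

n<ᵇn : ∀ n → (n <ᵇ n) ≡ false
n<ᵇn n = ¬T⇒≡false (λ t → <-irrefl refl (<ᵇ⇒< n n t))

leastBelow-threshold : (f : ℕ → Bool) (t : ℕ) →
  (∀ m → IsTrue (f m) → t ≤ m) → (∀ m → t ≤ m → IsTrue (f m)) →
  ∀ n → (n ≤ t → leastBelow f n ≡ n) × (t < n → leastBelow f n ≡ t)
leastBelow-threshold f t below above zero = (λ _ → refl) , (λ ())
leastBelow-threshold f t below above (suc n) = small , large
  where
  IH = leastBelow-threshold f t below above n
  small : suc n ≤ t → leastBelow f (suc n) ≡ suc n
  small le rewrite proj₁ IH (≤-trans (n≤1+n n) le) | n<ᵇn n
    | ¬T⇒≡false {f n} (λ fn → <-irrefl refl (<-≤-trans le (below n fn))) = refl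
  large : t < suc n → leastBelow f (suc n) ≡ t
  large lt with t <? n
  ... | yes t<n rewrite proj₂ IH t<n | T⇒≡true (<⇒<ᵇ t<n) = refl
  ... | no t≮n with ≤-antisym (≤-pred lt) (≮⇒≥ t≮n)
  ... | refl rewrite proj₁ IH ≤-refl | n<ᵇn n | T⇒≡true (above n ≤-refl) = refl

-- These properties pin down the graph distance.
record IsPathMetric (G : Graph) (δ : Fin (order G) → Fin (order G) → ℕ) : Set where
  field
    δ-refl    : ∀ u → δ u u ≡ 0
    δ-zero    : ∀ u v → δ u v ≡ 0 → u ≡ v
    δ-edge    : ∀ u w v → IsTrue (adj G u w) → δ u v ≤ suc (δ w v)
    δ-descend : ∀ u v d → δ u v ≡ suc d → Σ (Fin (order G)) λ w → IsTrue (adj G u w) × δ w v ≡ d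
    δ-bounded : ∀ u v → δ u v < order G

module _ {G : Graph} {δ : Fin (order G) → Fin (order G) → ℕ} (M : IsPathMetric G δ) where
  open IsPathMetric M

  reach⇒δ≤ : ∀ m u v → IsTrue (reach G m u v) → δ u v ≤ m
  reach⇒δ≤ zero u v r with toℕ-injective (≡ᵇ⇒≡ (toℕ u) (toℕ v) r)
  ... | refl = ≤-reflexive (δ-refl u)
  reach⇒δ≤ (suc m) u v r with Equivalence.to T-∨ r
  ... | inj₁ short = m≤n⇒m≤1+n (reach⇒δ≤ m u v short)
  ... | inj₂ viaNeighbour with find (any⁻ _ (allFin (order G)) viaNeighbour)
  ... | w , _ , step with Equivalence.to T-∧ step
  ... | uw , wv = ≤-trans (δ-edge u w v uw) (s≤s (reach⇒δ≤ m w v wv))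

  δ≤⇒reach : ∀ m u v → δ u v ≤ m → IsTrue (reach G m u v)
  δ≤⇒reach zero u v le = ≡⇒≡ᵇ (toℕ u) (toℕ v) (cong toℕ (δ-zero u v (n≤0⇒n≡0 le)))
  δ≤⇒reach (suc m) u v le with δ u v ≤? m
  ... | yes le' = Equivalence.from T-∨ (inj₁ (δ≤⇒reach m u v le'))
  ... | no nle with δ-descend u v m (≤-antisym le (≰⇒> nle))
  ... | w , uw , wv = Equivalence.from T-∨ (inj₂ (any⁺ _ (lose (∈-allFin w)
          (Equivalence.from T-∧ (uw , δ≤⇒reach m w v (≤-reflexive wv))))))

  dist≡δ : ∀ u v → dist G u v ≡ δ u v
  dist≡δ u v = proj₂ (leastBelow-threshold (λ m → reach G m u v) (δ u v)
    (λ m → reach⇒δ≤ m u v) (λ m → δ≤⇒reach m u v) (order G)) (δ-bounded u v)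

-- For a label
-- i, legStart ks s i is the label just before the leg containing i (its
-- "start") and legLength ks s i is the length of that leg.
legStart : List ℕ → ℕ → ℕ → ℕ
legStart []       s i = s
legStart (k ∷ ks) s i with i ≤? s + k
... | yes _ = s
... | no  _ = legStart ks (s + k) i

legLength : List ℕ → ℕ → ℕ → ℕ
legLength []       s i = 0
legLength (k ∷ ks) s i with i ≤? s + k
... | yes _ = k
... | no  _ = legLength ks (s + k) i

noLabel : ∀ s i → s < i → ¬ (i ≤ s + 0)
noLabel s i si is = <-irrefl refl (<-≤-trans si (≤-trans is (≤-reflexive (+-identityʳ s))))

inRest : ∀ s k ks {i} → i ≤ s + (k + sum ks) → i ≤ s + k + sum ks
inRest s k ks le = ≤-trans le (≤-reflexive (sym (+-assoc s k (sum ks))))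

offset≤legStart : ∀ ks s i → s ≤ legStart ks s i
offset≤legStart []       s i = ≤-refl
offset≤legStart (k ∷ ks) s i with i ≤? s + k
... | yes _ = ≤-refl
... | no  _ = ≤-trans (m≤m+n s k) (offset≤legStart ks (s + k) i)

legRange : ∀ ks s i → s < i → i ≤ s + sum ks →
  (legStart ks s i < i) × (i ≤ legStart ks s i + legLength ks s i)
  × (legStart ks s i + legLength ks s i ≤ s + sum ks)
legRange []       s i si is = ⊥-elim (noLabel s i si is)
legRange (k ∷ ks) s i si is with i ≤? s + k
... | yes p = si , p , +-monoʳ-≤ s (m≤m+n k (sum ks))
... | no  p with legRange ks (s + k) i (≰⇒> p) (inRest s k ks is)
... | a , b , c = a , b , ≤-trans c (≤-reflexive (+-assoc s k (sum ks)))

legStable : ∀ ks s i j → legStart ks s i < j → j ≤ legStart ks s i + legLength ks s i →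
  (legStart ks s j ≡ legStart ks s i) × (legLength ks s j ≡ legLength ks s i)
legStable []       s i j a b = ⊥-elim (noLabel s j a b)
legStable (k ∷ ks) s i j a b with i ≤? s + k
legStable (k ∷ ks) s i j a b | yes p with j ≤? s + k
... | yes q = refl , refl
... | no  q = ⊥-elim (q b)
legStable (k ∷ ks) s i j a b | no p with j ≤? s + k
... | yes q = ⊥-elim (<-irrefl refl (<-≤-trans (≤-<-trans (offset≤legStart ks (s + k) i) a) q))
... | no  q = legStable ks (s + k) i j a b

sameStart⇒sameLength : ∀ ks s i j → s < i → s < j →
  legStart ks s i ≡ legStart ks s j → legLength ks s i ≡ legLength ks s j
sameStart⇒sameLength []       s i j _ _ _ = refl
sameStart⇒sameLength (k ∷ ks) s i j si sj e with i ≤? s + k | j ≤? s + k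
... | yes p | yes q = refl
... | yes p | no  q = ⊥-elim (<-irrefl refl (<-≤-trans si (≤-trans p
        (≤-trans (offset≤legStart ks (s + k) j) (≤-reflexive (sym e))))))
... | no  p | yes q = ⊥-elim (<-irrefl refl (<-≤-trans sj (≤-trans q
        (≤-trans (offset≤legStart ks (s + k) i) (≤-reflexive e)))))
... | no  p | no  q = sameStart⇒sameLength ks (s + k) i j (≰⇒> p) (≰⇒> q) e

legsOrdered : ∀ ks s i j → i ≤ j → (legStart ks s i ≡ legStart ks s j) ⊎ (i ≤ legStart ks s j)
legsOrdered []       s i j _ = inj₁ refl
legsOrdered (k ∷ ks) s i j ij with i ≤? s + k | j ≤? s + k
... | yes p | yes q = inj₁ refl
... | yes p | no  q = inj₂ (≤-trans p (offset≤legStart ks (s + k) j))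
... | no  p | yes q = ⊥-elim (p (≤-trans ij q))
... | no  p | no  q = legsOrdered ks (s + k) i j ij

legLength∈ : ∀ ks s i → s < i → i ≤ s + sum ks → legLength ks s i ∈ ks
legLength∈ []       s i si is = ⊥-elim (noLabel s i si is)
legLength∈ (k ∷ ks) s i si is with i ≤? s + k
... | yes p = here refl
... | no  p = there (legLength∈ ks (s + k) i (≰⇒> p) (inRest s k ks is))

Ascending : List ℕ → Set
Ascending []       = ⊤
Ascending (k ∷ ks) = All (k <_) ks × Ascending ks

sameLength⇒sameStart : ∀ ks s i j → Ascending ks → s < i → i ≤ s + sum ks → s < j → j ≤ s + sum ks →
  legLength ks s i ≡ legLength ks s j → legStart ks s i ≡ legStart ks s j
sameLength⇒sameStart []       s i j _ _ _ _ _ _ = refl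
sameLength⇒sameStart (k ∷ ks) s i j (k<ks , asc) si is sj js e with i ≤? s + k | j ≤? s + k
... | yes p | yes q = refl
... | yes p | no  q = ⊥-elim (<-irrefl e (All.lookup k<ks (legLength∈ ks (s + k) j (≰⇒> q) (inRest s k ks js))))
... | no  p | yes q = ⊥-elim (<-irrefl (sym e) (All.lookup k<ks (legLength∈ ks (s + k) i (≰⇒> p) (inRest s k ks is))))
... | no  p | no  q = sameLength⇒sameStart ks (s + k) i j asc (≰⇒> p) (inRest s k ks is) (≰⇒> q) (inRest s k ks js) e

legStart-first : ∀ k ks s i → i ≤ s + k → legStart (k ∷ ks) s i ≡ s
legStart-first k ks s i p with i ≤? s + k
... | yes _ = refl
... | no  q = ⊥-elim (q p)

EdgeShape : List ℕ → ℕ → ℕ → ℕ → Set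
EdgeShape ks s x y = (x ≡ 0 × y ≡ suc (legStart ks s y)) ⊎ (legStart ks s y < x × suc x ≡ y)

innerEdge≤ : ∀ s k j → suc j < k → s + suc j + 1 ≤ s + k
innerEdge≤ s k j lt = ≤-trans (≤-reflexive (+-assoc s (suc j) 1))
  (+-monoʳ-≤ s (≤-trans (≤-reflexive (+-comm (suc j) 1)) lt))

starEdge-shape : ∀ ks s x y → (x , y) ∈ starEdges s ks →
  (s < y) × (y ≤ s + sum ks) × EdgeShape ks s x y
starEdge-shape (k ∷ ks) s x y mem with ∈-++⁻ (legEdges s k) mem
... | inj₁ m with ∈-map⁻ _ m
... | zero , j∈ , refl rewrite legStart-first k ks s (s + 1) (+-monoʳ-≤ s (∈-upTo⁻ j∈)) =
  ≤-reflexive (+-comm 1 s) ,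
  +-monoʳ-≤ s (≤-trans (∈-upTo⁻ j∈) (m≤m+n k (sum ks))) ,
  inj₁ (refl , +-comm s 1)
... | suc j , j∈ , refl rewrite legStart-first k ks s (s + suc j + 1) (innerEdge≤ s k j (∈-upTo⁻ j∈)) =
  ≤-trans (s≤s (m≤m+n s (suc j))) (≤-reflexive (+-comm 1 (s + suc j))) ,
  ≤-trans (innerEdge≤ s k j (∈-upTo⁻ j∈)) (+-monoʳ-≤ s (m≤m+n k (sum ks))) ,
  inj₂ (≤-trans (≤-reflexive (+-comm 1 s)) (+-monoʳ-≤ s (s≤s z≤n)) , +-comm 1 (s + suc j))
starEdge-shape (k ∷ ks) s x y mem | inj₂ m with starEdge-shape ks (s + k) x y m
... | sy , ys , shape with y ≤? s + k
... | yes q = ⊥-elim (<-irrefl refl (<-≤-trans sy q))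
... | no  q = ≤-trans (s≤s (m≤m+n s k)) sy , ≤-trans ys (≤-reflexive (+-assoc s k (sum ks))) , shape

legNonempty : ∀ s k y → s < y → y ≤ s + k → 0 < k
legNonempty s zero    y sy yk = ⊥-elim (noLabel s y sy yk)
legNonempty s (suc k) y sy yk = s≤s z≤n

innerEdge∈ : ∀ s k x → s < x → suc x ≤ s + k → (x , suc x) ∈ legEdges s k
innerEdge∈ s k x lt q =
  subst (_∈ legEdges s k) (cong₂ _,_ ex (trans (+-comm _ 1) (cong suc ex))) (∈-map⁺ _ (∈-upTo⁺ jk))
  where
  j = x ∸ suc s
  ex : s + suc j ≡ x
  ex = trans (+-suc s j) (m+[n∸m]≡n lt)
  jk : suc j < k
  jk = +-cancelˡ-≤ s _ _ (≤-trans (≤-reflexive (trans (+-suc s (suc j)) (cong suc ex))) q)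

starEdge-complete : ∀ ks s x y → s < y → y ≤ s + sum ks → EdgeShape ks s x y → (x , y) ∈ starEdges s ks
starEdge-complete []       s x y sy ys _ = ⊥-elim (noLabel s y sy ys)
starEdge-complete (k ∷ ks) s x y sy ys shape with y ≤? s + k
... | no  q = ∈-++⁺ʳ (legEdges s k) (starEdge-complete ks (s + k) x y (≰⇒> q) (inRest s k ks ys) shape)
... | yes q with shape
... | inj₁ (refl , refl) = ∈-++⁺ˡ (subst (_∈ legEdges s k) (cong (0 ,_) (+-comm s 1))
        (∈-map⁺ _ (∈-upTo⁺ (legNonempty s k y sy q))))
... | inj₂ (lt , refl) = ∈-++⁺ˡ (innerEdge∈ s k x lt q)

edgeAdj-sound : ∀ es u v → IsTrue (edgeAdj es u v) →
  Σ ℕ λ x → Σ ℕ λ y → ((x , y) ∈ es) × ((x ≡ u × y ≡ v) ⊎ (x ≡ v × y ≡ u))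
edgeAdj-sound es u v t with find (any⁻ _ es t)
... | (x , y) , mem , px with Equivalence.to T-∨ px
... | inj₁ q with Equivalence.to T-∧ q
... | a , b = x , y , mem , inj₁ (≡ᵇ⇒≡ x u a , ≡ᵇ⇒≡ y v b)
edgeAdj-sound es u v t | (x , y) , mem , px | inj₂ q with Equivalence.to T-∧ q
... | a , b = x , y , mem , inj₂ (≡ᵇ⇒≡ x v a , ≡ᵇ⇒≡ y u b)

edgeAdj-forward : ∀ es u v → (u , v) ∈ es → IsTrue (edgeAdj es u v)
edgeAdj-forward es u v mem = any⁺ _ (lose mem (Equivalence.from T-∨ (inj₁ (Equivalence.from T-∧
  (≡⇒≡ᵇ u u refl , ≡⇒≡ᵇ v v refl)))))

edgeAdj-backward : ∀ es u v → (v , u) ∈ es → IsTrue (edgeAdj es u v)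
edgeAdj-backward es u v mem = any⁺ _ (lose mem (Equivalence.from T-∨ (inj₂ (Equivalence.from T-∧
  (≡⇒≡ᵇ v v refl , ≡⇒≡ᵇ u u refl)))))

∣n-1+n∣≡1 : ∀ n → ∣ n - suc n ∣ ≡ 1
∣n-1+n∣≡1 zero    = refl
∣n-1+n∣≡1 (suc n) = ∣n-1+n∣≡1 n

∣m-n∣≤m+n : ∀ m n → ∣ m - n ∣ ≤ m + n
∣m-n∣≤m+n m n = ≤-trans (∣m-n∣≤m⊔n m n) (m⊔n≤m+n m n)

∣m-n∣-stepUp : ∀ m n d → m < n → ∣ m - n ∣ ≡ suc d → ∣ suc m - n ∣ ≡ d
∣m-n∣-stepUp zero    (suc n) d lt       e = suc-injective e
∣m-n∣-stepUp (suc m) (suc n) d (s≤s lt) e = ∣m-n∣-stepUp m n d lt e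

∣m-n∣-stepDown : ∀ m n d → n ≤ m → ∣ suc m - n ∣ ≡ suc d → ∣ m - n ∣ ≡ d
∣m-n∣-stepDown m       zero    d le       e = trans (∣-∣-identityʳ m) (suc-injective e)
∣m-n∣-stepDown (suc m) (suc n) d (s≤s le) e = ∣m-n∣-stepDown m n d le e

1+m∸m≡1 : ∀ m → suc m ∸ m ≡ 1
1+m∸m≡1 m = trans (+-∸-assoc 1 {m} ≤-refl) (cong suc (n∸n≡0 m))

module Star (ks : List ℕ) where
  N : ℕ
  N = sum ks

  E : List (ℕ × ℕ)
  E = starEdges 0 ks

  start legLen depth : ℕ → ℕ
  start  i = legStart ks 0 i
  legLen i = legLength ks 0 i
  depth  i = i ∸ start i

  start<label : ∀ i → 0 < i → i ≤ N → start i < i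
  start<label i p q = proj₁ (legRange ks 0 i p q)

  label≤end : ∀ i → 0 < i → i ≤ N → i ≤ start i + legLen i
  label≤end i p q = proj₁ (proj₂ (legRange ks 0 i p q))

  end≤N : ∀ i → 0 < i → i ≤ N → start i + legLen i ≤ N
  end≤N i p q = proj₂ (proj₂ (legRange ks 0 i p q))

  start+depth : ∀ i → 0 < i → i ≤ N → start i + depth i ≡ i
  start+depth i p q = m+[n∸m]≡n (<⇒≤ (start<label i p q))

  depth-centre : depth 0 ≡ 0
  depth-centre = 0∸n≡0 (start 0)

  depth-pos : ∀ i → 0 < i → i ≤ N → 0 < depth i
  depth-pos i p q = m<n⇒0<n∸m (start<label i p q)

  depth≤legLen : ∀ i → 0 < i → i ≤ N → depth i ≤ legLen i
  depth≤legLen i p q = ≤-trans (∸-monoˡ-≤ (start i) (label≤end i p q))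
                               (≤-reflexive (m+n∸m≡n (start i) (legLen i)))

  depth≤label : ∀ u → depth u ≤ u
  depth≤label u = m∸n≤m u (start u)

  depth≡0⇒centre : ∀ u → u ≤ N → depth u ≡ 0 → u ≡ 0
  depth≡0⇒centre zero    _ _ = refl
  depth≡0⇒centre (suc u) q e = ⊥-elim (<-irrefl (sym e) (depth-pos (suc u) (s≤s z≤n) q))

  SameLeg : ℕ → ℕ → Set
  SameLeg i j = (0 < i) × (0 < j) × (start i ≡ start j)

  SameLeg? : ∀ i j → Dec (SameLeg i j)
  SameLeg? i j = (0 <? i) ×-dec ((0 <? j) ×-dec (start i ≟ start j))

  SameLeg-sym : ∀ {i j} → SameLeg i j → SameLeg j i
  SameLeg-sym (a , b , c) = b , a , sym c

  SameLeg-trans : ∀ {i j k} → SameLeg i j → SameLeg j k → SameLeg i k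
  SameLeg-trans (a , b , c) (_ , d , e) = a , d , trans c e

  -- The tree distance: along a leg the depths are subtracted, otherwise the
  -- path passes through the centre and the depths add up.
  δ : ℕ → ℕ → ℕ
  δ i j with SameLeg? i j
  ... | yes _ = ∣ depth i - depth j ∣
  ... | no  _ = depth i + depth j

  δ-same : ∀ {i j} → SameLeg i j → δ i j ≡ ∣ depth i - depth j ∣
  δ-same {i} {j} s with SameLeg? i j
  ... | yes _ = refl
  ... | no  n = ⊥-elim (n s)

  δ-other : ∀ {i j} → ¬ SameLeg i j → δ i j ≡ depth i + depth j
  δ-other {i} {j} s with SameLeg? i j
  ... | yes y = ⊥-elim (s y)
  ... | no  _ = refl

  δ-centre : ∀ v → δ 0 v ≡ depth v
  δ-centre v = trans (δ-other (λ { (() , _) })) (cong (_+ depth v) depth-centre)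

  δ-centreʳ : ∀ v → δ v 0 ≡ depth v
  δ-centreʳ v = trans (δ-other (λ { (_ , () , _) })) (trans (cong (depth v +_) depth-centre) (+-identityʳ (depth v)))

  δ-sym : ∀ i j → δ i j ≡ δ j i
  δ-sym i j with SameLeg? i j | SameLeg? j i
  ... | yes _ | yes _ = ∣-∣-comm (depth i) (depth j)
  ... | yes s | no  n = ⊥-elim (n (SameLeg-sym s))
  ... | no  n | yes s = ⊥-elim (n (SameLeg-sym s))
  ... | no  _ | no  _ = +-comm (depth i) (depth j)

  δ-triangle : ∀ u v w → δ u v ≤ δ u w + δ w v
  δ-triangle u v w with SameLeg? u v | SameLeg? u w | SameLeg? w v
  ... | yes uv | yes uw | yes wv = ∣-∣-triangle (depth u) (depth w) (depth v)
  ... | yes uv | yes uw | no  wv = ⊥-elim (wv (SameLeg-trans (SameLeg-sym uw) uv))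
  ... | yes uv | no  uw | yes wv = ⊥-elim (uw (SameLeg-trans uv (SameLeg-sym wv)))
  ... | yes uv | no  uw | no  wv = ≤-trans (∣m-n∣≤m+n (depth u) (depth v))
        (+-mono-≤ (m≤m+n (depth u) (depth w)) (m≤n+m (depth v) (depth w)))
  ... | no  uv | yes uw | yes wv = ⊥-elim (uv (SameLeg-trans uw wv))
  ... | no  uv | yes uw | no  wv = ≤-trans (+-monoˡ-≤ (depth v) (m≤∣m-n∣+n (depth u) (depth w)))
        (≤-reflexive (+-assoc ∣ depth u - depth w ∣ (depth w) (depth v)))
  ... | no  uv | no  uw | yes wv = ≤-trans (+-monoʳ-≤ (depth u) (m≤n+∣n-m∣ (depth v) (depth w)))
        (≤-reflexive (sym (+-assoc (depth u) (depth w) ∣ depth w - depth v ∣)))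
  ... | no  uv | no  uw | no  wv = +-mono-≤ (m≤m+n (depth u) (depth w)) (m≤n+m (depth v) (depth w))

  δ-starEdge : ∀ x y → (x , y) ∈ E → δ x y ≡ 1
  δ-starEdge x y mem with starEdge-shape ks 0 x y mem
  ... | py , yN , inj₁ (refl , ey) = trans (δ-centre y) (trans (cong (_∸ start y) ey) (1+m∸m≡1 (start y)))
  ... | py , yN , inj₂ (lt , refl) = trans (δ-same sameLeg) (trans (cong₂ ∣_-_∣ dx dy) (∣n-1+n∣≡1 (x ∸ start y)))
    where
    stable = legStable ks 0 (suc x) x lt (≤-trans (n≤1+n x) (label≤end (suc x) py yN))
    sameLeg : SameLeg x (suc x)
    sameLeg = ≤-trans (s≤s z≤n) lt , py , proj₁ stable
    dx : depth x ≡ x ∸ start (suc x)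
    dx = cong (x ∸_) (proj₁ stable)
    dy : depth (suc x) ≡ suc (x ∸ start (suc x))
    dy = +-∸-assoc 1 (<⇒≤ lt)

  adj⇒δ≡1 : ∀ u w → IsTrue (edgeAdj E u w) → δ u w ≡ 1
  adj⇒δ≡1 u w t with edgeAdj-sound E u w t
  ... | x , y , mem , inj₁ (refl , refl) = δ-starEdge x y mem
  ... | x , y , mem , inj₂ (refl , refl) = trans (δ-sym u w) (δ-starEdge x y mem)

  δ-edge : ∀ u w v → IsTrue (edgeAdj E u w) → δ u v ≤ suc (δ w v)
  δ-edge u w v t = ≤-trans (δ-triangle u v w) (≤-reflexive (cong (_+ δ w v) (adj⇒δ≡1 u w t)))

  δ-zero : ∀ u v → u ≤ N → v ≤ N → δ u v ≡ 0 → u ≡ v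
  δ-zero u v uN vN e with SameLeg? u v
  ... | yes (pu , pv , el) = trans (sym (start+depth u pu uN))
        (trans (cong₂ _+_ el (∣m-n∣≡0⇒m≡n e)) (start+depth v pv vN))
  ... | no  _ = trans (depth≡0⇒centre u uN (m+n≡0⇒m≡0 (depth u) e))
                      (sym (depth≡0⇒centre v vN (m+n≡0⇒n≡0 (depth u) e)))

  δ-refl : ∀ u → δ u u ≡ 0
  δ-refl u with SameLeg? u u
  ... | yes _ = ∣n-n∣≡0 (depth u)
  δ-refl zero    | no _ = cong₂ _+_ depth-centre depth-centre
  δ-refl (suc u) | no n = ⊥-elim (n (s≤s z≤n , s≤s z≤n , refl))

  -- If u ≤ v lie on different legs, the whole leg of u precedes v, so the
  -- depths add up to at most v ≤ N.
  otherLegs≤N : ∀ u v → 0 < u → 0 < v → v ≤ N → u ≤ v → ¬ SameLeg u v → depth u + depth v ≤ N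
  otherLegs≤N u v pu pv vN le n with legsOrdered ks 0 u v le
  ... | inj₁ e = ⊥-elim (n (pu , pv , e))
  ... | inj₂ ul = ≤-trans (+-monoˡ-≤ (depth v) (≤-trans (depth≤label u) ul))
                          (≤-trans (≤-reflexive (start+depth v pv vN)) vN)

  δ≤N : ∀ u v → u ≤ N → v ≤ N → δ u v ≤ N
  δ≤N u v uN vN with SameLeg? u v
  ... | yes _ = ≤-trans (∣m-n∣≤m⊔n (depth u) (depth v))
                  (⊔-lub (≤-trans (depth≤label u) uN) (≤-trans (depth≤label v) vN))
  δ≤N zero    v       uN vN | no _ = ≤-trans (≤-reflexive (cong (_+ depth v) depth-centre)) (≤-trans (depth≤label v) vN)
  δ≤N (suc u) zero    uN vN | no _ = ≤-trans (≤-reflexive (trans (cong (depth (suc u) +_) depth-centre) (+-identityʳ _)))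
                                       (≤-trans (depth≤label (suc u)) uN)
  δ≤N (suc u) (suc v) uN vN | no n with ≤-total (suc u) (suc v)
  ... | inj₁ le = otherLegs≤N (suc u) (suc v) (s≤s z≤n) (s≤s z≤n) vN le n
  ... | inj₂ le = ≤-trans (≤-reflexive (+-comm (depth (suc u)) (depth (suc v))))
                    (otherLegs≤N (suc v) (suc u) (s≤s z≤n) (s≤s z≤n) uN le (n ∘ SameLeg-sym))

  record InwardStep (u' : ℕ) : Set where
    field
      start<pred  : start (suc u') < u'
      sameStart   : start u' ≡ start (suc u')
      edge        : IsTrue (edgeAdj E (suc u') u')
      depthStep   : depth (suc u') ≡ suc (depth u')

    sameLeg : SameLeg u' (suc u')
    sameLeg = ≤-trans (s≤s z≤n) start<pred , s≤s z≤n , sameStart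

  inwardStep : ∀ u' → suc u' ≤ N → 2 ≤ depth (suc u') → InwardStep u'
  inwardStep u' uN two = record
    { start<pred = below ; sameStart = proj₁ stable ; edge = edge
    ; depthStep = trans (+-∸-assoc 1 (<⇒≤ below)) (cong (λ z → suc (u' ∸ z)) (sym (proj₁ stable))) }
    where
    L = start (suc u')
    below : L < u'
    below = ≤-pred (≤-trans (≤-reflexive (+-comm 2 L))
              (≤-trans (+-monoʳ-≤ L two) (≤-reflexive (start+depth (suc u') (s≤s z≤n) uN))))
    stable = legStable ks 0 (suc u') u' below (≤-trans (n≤1+n u') (label≤end (suc u') (s≤s z≤n) uN))
    edge : IsTrue (edgeAdj E (suc u') u')
    edge = edgeAdj-backward E (suc u') u' (starEdge-complete ks 0 u' (suc u') (s≤s z≤n) uN (inj₂ (below , refl)))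

  CloserNeighbour : ℕ → ℕ → ℕ → Set
  CloserNeighbour u v d = Σ ℕ λ w → (w ≤ N) × IsTrue (edgeAdj E u w) × δ w v ≡ d

  stepOutward : ∀ u v d → u ≤ N → v ≤ N → SameLeg u v → depth u < depth v →
    ∣ depth u - depth v ∣ ≡ suc d → CloserNeighbour u v d
  stepOutward u v d uN vN (pu , pv , el) lt e = suc u , ≤-trans su≤ (end≤N u pu uN) , edge , closer
    where
    su≤ : suc u ≤ start u + legLen u
    su≤ = ≤-trans (≤-reflexive (trans (cong suc (sym (start+depth u pu uN))) (sym (+-suc (start u) (depth u)))))
           (+-monoʳ-≤ (start u) (≤-trans lt (≤-trans (depth≤legLen v pv vN)
             (≤-reflexive (sym (sameStart⇒sameLength ks 0 u v pu pv el))))))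
    stable = legStable ks 0 u (suc u) (m<n⇒m<1+n (start<label u pu uN)) su≤
    edge : IsTrue (edgeAdj E u (suc u))
    edge = edgeAdj-forward E u (suc u) (starEdge-complete ks 0 u (suc u) (s≤s z≤n) (≤-trans su≤ (end≤N u pu uN))
             (inj₂ (subst (_< u) (sym (proj₁ stable)) (start<label u pu uN) , refl)))
    depthSuc : depth (suc u) ≡ suc (depth u)
    depthSuc = trans (cong (suc u ∸_) (proj₁ stable)) (+-∸-assoc 1 (<⇒≤ (start<label u pu uN)))
    closer : δ (suc u) v ≡ d
    closer = trans (δ-same (s≤s z≤n , pv , trans (proj₁ stable) el))
               (trans (cong (λ z → ∣ z - depth v ∣) depthSuc) (∣m-n∣-stepUp (depth u) (depth v) d lt e))

  stepInward : ∀ u' v d → suc u' ≤ N → v ≤ N → SameLeg (suc u') v → depth v < depth (suc u') →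
    ∣ depth (suc u') - depth v ∣ ≡ suc d → CloserNeighbour (suc u') v d
  stepInward u' v d uN vN (pu , pv , el) lt e = u' , ≤-trans (n≤1+n u') uN , InwardStep.edge step , closer
    where
    step = inwardStep u' uN (≤-trans (s≤s (depth-pos v pv vN)) lt)
    open InwardStep step using (sameStart; depthStep; start<pred)
    closer : δ u' v ≡ d
    closer = trans (δ-same (≤-trans (s≤s z≤n) start<pred , pv , trans sameStart el))
      (∣m-n∣-stepDown (depth u') (depth v) d (≤-pred (≤-trans lt (≤-reflexive depthStep)))
        (trans (cong (λ z → ∣ z - depth v ∣) (sym depthStep)) e))

  descendSameLeg : ∀ u v d → u ≤ N → v ≤ N → SameLeg u v → ∣ depth u - depth v ∣ ≡ suc d → CloserNeighbour u v d
  descendSameLeg u v d uN vN s e with depth u <? depth v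
  ... | yes lt = stepOutward u v d uN vN s lt e
  descendSameLeg zero     v d uN vN (() , _) e | no _
  descendSameLeg (suc u') v d uN vN s e | no nlt = stepInward u' v d uN vN s shallower e
    where
    shallower : depth v < depth (suc u')
    shallower = ≤∧≢⇒< (≮⇒≥ nlt) (λ eq → 0≢1+n (trans (sym (m≡n⇒∣m-n∣≡0 (sym eq))) e))

  -- On different legs the closer neighbour lies towards the centre, or is the
  -- first vertex of the leg of v when u is the centre.
  descendOtherLeg : ∀ u v d → u ≤ N → v ≤ N → ¬ SameLeg u v → depth u + depth v ≡ suc d → CloserNeighbour u v d
  descendOtherLeg zero zero d uN vN n e = ⊥-elim (0≢1+n (trans (sym (cong₂ _+_ depth-centre depth-centre)) e))
  descendOtherLeg zero (suc v') d uN vN n e = suc L , ≤-trans sL≤ (end≤N v (s≤s z≤n) vN) , edge , closer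
    where
    v = suc v'
    L = start v
    sL≤ : suc L ≤ L + legLen v
    sL≤ = ≤-trans (start<label v (s≤s z≤n) vN) (label≤end v (s≤s z≤n) vN)
    stable = legStable ks 0 v (suc L) ≤-refl sL≤
    edge : IsTrue (edgeAdj E 0 (suc L))
    edge = edgeAdj-forward E 0 (suc L) (starEdge-complete ks 0 0 (suc L) (s≤s z≤n) (≤-trans sL≤ (end≤N v (s≤s z≤n) vN))
             (inj₁ (refl , cong suc (sym (proj₁ stable)))))
    closer : δ (suc L) v ≡ d
    closer = trans (δ-same (s≤s z≤n , s≤s z≤n , proj₁ stable))
      (cong₂ ∣_-_∣ (trans (cong (suc L ∸_) (proj₁ stable)) (1+m∸m≡1 L))
                   (trans (sym (cong (_+ depth v) depth-centre)) e))
  descendOtherLeg (suc u') v d uN vN n e with depth (suc u') ≟ 1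
  ... | yes d1 = 0 , z≤n , edge , closer
    where
    L = start (suc u')
    first : suc u' ≡ suc L
    first = trans (sym (start+depth (suc u') (s≤s z≤n) uN)) (trans (cong (L +_) d1) (+-comm L 1))
    edge : IsTrue (edgeAdj E (suc u') 0)
    edge = edgeAdj-backward E (suc u') 0 (starEdge-complete ks 0 0 (suc u') (s≤s z≤n) uN (inj₁ (refl , first)))
    closer : δ 0 v ≡ d
    closer = trans (δ-centre v) (suc-injective (trans (cong (_+ depth v) (sym d1)) e))
  ... | no d≢1 = u' , ≤-trans (n≤1+n u') uN , InwardStep.edge step , closer
    where
    step = inwardStep u' uN (≤∧≢⇒< (depth-pos (suc u') (s≤s z≤n) uN) (λ eq → d≢1 (sym eq)))
    open InwardStep step using (sameLeg; depthStep)
    closer : δ u' v ≡ d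
    closer = trans (δ-other (λ s → n (SameLeg-trans (SameLeg-sym sameLeg) s)))
               (suc-injective (trans (cong (_+ depth v) (sym depthStep)) e))

  δ-descend : ∀ u v d → u ≤ N → v ≤ N → δ u v ≡ suc d → CloserNeighbour u v d
  δ-descend u v d uN vN e with SameLeg? u v
  ... | yes s = descendSameLeg u v d uN vN s e
  ... | no  n = descendOtherLeg u v d uN vN n e

  label≤N : (u : Fin (suc N)) → toℕ u ≤ N
  label≤N u = ≤-pred (toℕ<n u)

  isPathMetric : IsPathMetric (starlike ks) (λ u v → δ (toℕ u) (toℕ v))
  isPathMetric = record
    { δ-refl    = λ u → δ-refl (toℕ u)
    ; δ-zero    = λ u v e → toℕ-injective (δ-zero (toℕ u) (toℕ v) (label≤N u) (label≤N v) e)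
    ; δ-edge    = λ u w v → δ-edge (toℕ u) (toℕ w) (toℕ v)
    ; δ-descend = descend
    ; δ-bounded = λ u v → s≤s (δ≤N (toℕ u) (toℕ v) (label≤N u) (label≤N v)) }
    where
    descend : ∀ (u v : Fin (suc N)) d → δ (toℕ u) (toℕ v) ≡ suc d →
      Σ (Fin (suc N)) λ w → IsTrue (edgeAdj E (toℕ u) (toℕ w)) × δ (toℕ w) (toℕ v) ≡ d
    descend u v d e with δ-descend (toℕ u) (toℕ v) d (label≤N u) (label≤N v) e
    ... | w , wN , uw , wv = fromℕ< (s≤s wN) ,
      subst (λ z → IsTrue (edgeAdj E (toℕ u) z) × δ z (toℕ v) ≡ d) (sym (toℕ-fromℕ< (s≤s wN))) (uw , wv)

  dist-star : ∀ u v → dist (starlike ks) u v ≡ δ (toℕ u) (toℕ v)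
  dist-star = dist≡δ isPathMetric

sumBelow : (ℕ → ℕ) → ℕ → ℕ
sumBelow h zero = 0
sumBelow h (suc n) = h 0 + sumBelow (h ∘ suc) n

sum-tabulate : ∀ n (h : ℕ → ℕ) → sum (tabulate {n = n} (λ u → h (toℕ u))) ≡ sumBelow h n
sum-tabulate zero h = refl
sum-tabulate (suc n) h = cong (h 0 +_) (sum-tabulate n (h ∘ suc))

sum-allFin : ∀ n (h : ℕ → ℕ) → sum (map (λ u → h (toℕ u)) (allFin n)) ≡ sumBelow h n
sum-allFin n h = trans (cong sum (map-tabulate {n = n} (λ u → u) (λ u → h (toℕ u)))) (sum-tabulate n h)

sumBelow-last : ∀ h n → sumBelow h (suc n) ≡ sumBelow h n + h n
sumBelow-last h zero = +-comm (h 0) 0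
sumBelow-last h (suc n) = trans (cong (h 0 +_) (sumBelow-last (h ∘ suc) n)) (sym (+-assoc (h 0) _ _))

sumBelow-+ : ∀ f g n → sumBelow (λ i → f i + g i) n ≡ sumBelow f n + sumBelow g n
sumBelow-+ f g zero = refl
sumBelow-+ f g (suc n) rewrite sumBelow-+ (f ∘ suc) (g ∘ suc) n = interchange (f 0) (g 0) (sumBelow (f ∘ suc) n) (sumBelow (g ∘ suc) n)
  where
  interchange : ∀ a b c d → a + b + (c + d) ≡ a + c + (b + d)
  interchange = solve-∀

sumBelow-const : ∀ c n → sumBelow (λ _ → c) n ≡ n * c
sumBelow-const c zero = refl
sumBelow-const c (suc n) = cong (c +_) (sumBelow-const c n)

sumBelow-* : ∀ c f n → sumBelow (λ i → c * f i) n ≡ c * sumBelow f n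
sumBelow-* c f zero = sym (*-zeroʳ c)
sumBelow-* c f (suc n) = trans (cong (c * f 0 +_) (sumBelow-* c (f ∘ suc) n)) (sym (*-distribˡ-+ c (f 0) _))

sumBelow-cong : ∀ f g n → (∀ i → i < n → f i ≡ g i) → sumBelow f n ≡ sumBelow g n
sumBelow-cong f g zero h = refl
sumBelow-cong f g (suc n) h = cong₂ _+_ (h 0 (s≤s z≤n)) (sumBelow-cong (f ∘ suc) (g ∘ suc) n (λ i lt → h (suc i) (s≤s lt)))

between : ℕ → ℕ → ℕ → ℕ
between v e i with v ≤? i | i ≤? e
... | yes _ | yes _ = 1
... | yes _ | no _ = 0
... | no _ | _ = 0

between-in : ∀ v e i → v ≤ i → i ≤ e → between v e i ≡ 1
between-in v e i p q with v ≤? i | i ≤? e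
... | yes _ | yes _ = refl
... | yes _ | no n = ⊥-elim (n q)
... | no n | _ = ⊥-elim (n p)

between-before : ∀ v e i → ¬ v ≤ i → between v e i ≡ 0
between-before v e i p with v ≤? i | i ≤? e
... | yes y | _ = ⊥-elim (p y)
... | no _ | _ = refl

between-after : ∀ v e i → ¬ i ≤ e → between v e i ≡ 0
between-after v e i p with v ≤? i | i ≤? e
... | yes _ | yes y = ⊥-elim (p y)
... | yes _ | no _ = refl
... | no _ | _ = refl

countBetween-step : ∀ v e n → Dec (n ≤ e) → Dec (v ≤ n) → (n ⊓ suc e) ∸ v + between v e n ≡ (suc n ⊓ suc e) ∸ v
countBetween-step v e n (no ne) _ rewrite between-after v e n ne | m≥n⇒m⊓n≡n (≰⇒> ne) | m≥n⇒m⊓n≡n (≤-trans (≰⇒> ne) (n≤1+n n))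
        = +-identityʳ _
countBetween-step v e n (yes ne) (yes vn) rewrite between-in v e n vn ne | m≤n⇒m⊓n≡m (≤-trans ne (n≤1+n e)) | m≤n⇒m⊓n≡m (s≤s ne)
        = trans (+-comm _ 1) (sym (+-∸-assoc 1 vn))
countBetween-step v e n (yes ne) (no vn) rewrite between-before v e n vn | m≤n⇒m⊓n≡m (≤-trans ne (n≤1+n e)) | m≤n⇒m⊓n≡m (s≤s ne)
        = trans (+-identityʳ _) (trans (m≤n⇒m∸n≡0 (≤-trans (n≤1+n n) (≰⇒> vn))) (sym (m≤n⇒m∸n≡0 (≰⇒> vn))))

countBetween : ∀ v e n → sumBelow (between v e) n ≡ (n ⊓ suc e) ∸ v
countBetween v e zero = sym (0∸n≡0 v)
countBetween v e (suc n) = trans (sumBelow-last (between v e) n) (trans (cong (_+ between v e n) (countBetween v e n)) (countBetween-step v e n (n ≤? e) (v ≤? n)))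

∣a-1+b∣-beyond : ∀ a b → suc b ≤ a → ∣ a - suc b ∣ + 2 * 1 ≡ ∣ a - b ∣ + 1
∣a-1+b∣-beyond (suc a) zero    _        = trans (cong (_+ 2) (∣-∣-identityʳ a)) (+-suc a 1)
∣a-1+b∣-beyond (suc a) (suc b) (s≤s le) = ∣a-1+b∣-beyond a b le

∣a-1+b∣-before : ∀ a b → a ≤ b → ∣ a - suc b ∣ + 2 * 0 ≡ ∣ a - b ∣ + 1
∣a-1+b∣-before zero    b       _        = trans (+-identityʳ (suc b)) (+-comm 1 b)
∣a-1+b∣-before (suc a) (suc b) (s≤s le) = ∣a-1+b∣-before a b le

-- The algebra that turns the outward steps into the closed formula.
formula-base : ∀ X Z N K → X + 2 * K ≡ Z + suc N → X + 1 * (2 * K) ≡ Z + 1 * (N + 1)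
formula-base X Z N K h = trans (cong (X +_) (*-identityˡ (2 * K))) (trans h (cong (Z +_) (suc≡1*[n+1] N)))
  where
  suc≡1*[n+1] : ∀ n → suc n ≡ 1 * (n + 1)
  suc≡1*[n+1] = solve-∀

formula-step : ∀ X Y Z N x r → X + 2 * suc r ≡ Y + suc N → Y + x * (2 * (suc x + r)) ≡ Z + x * (N + x) →
  X + suc x * (2 * (suc x + r)) ≡ Z + suc x * (N + suc x)
formula-step X Y Z N x r step IH = +-cancelʳ-≡ (Y + 2 * suc r) _ _
  (trans (regroup₁ X Y x r) (trans (cong₂ (λ a b → a + b + 2 * (suc x + r)) step IH) (regroup₂ Y Z N x r)))
  where
  regroup₁ : ∀ X Y x r → X + suc x * (2 * (suc x + r)) + (Y + 2 * suc r)
    ≡ X + 2 * suc r + (Y + x * (2 * (suc x + r))) + 2 * (suc x + r)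
  regroup₁ = solve-∀
  regroup₂ : ∀ Y Z N x r → Y + suc N + (Z + x * (N + x)) + 2 * (suc x + r)
    ≡ Z + suc x * (N + suc x) + (Y + 2 * suc r)
  regroup₂ = solve-∀

module Transmission (ks : List ℕ) where
  open Star ks

  Trδ : ℕ → ℕ
  Trδ v = sumBelow (λ i → δ i v) (suc N)

  Tr≡Trδ : ∀ v → Tr (starlike ks) v ≡ Trδ (toℕ v)
  Tr≡Trδ v = trans (cong sum (map-cong (λ u → dist-star u v) (allFin (suc N))))
                   (sum-allFin (suc N) (λ i → δ i (toℕ v)))

  end : ℕ → ℕ
  end v = start v + legLen v

  beyond⇒SameLeg : ∀ v i → 0 < v → v ≤ N → v ≤ i → i ≤ end v → SameLeg i v
  beyond⇒SameLeg v i pv vN vi ie =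
    ≤-trans pv vi , pv , proj₁ (legStable ks 0 v i (<-≤-trans (start<label v pv vN) vi) ie)

  SameLeg⇒≤end : ∀ v i → i ≤ N → SameLeg i v → i ≤ end v
  SameLeg⇒≤end v i iN (pi , pv , el) = ≤-trans (label≤end i pi iN)
    (≤-reflexive (cong₂ _+_ el (sameStart⇒sameLength ks 0 i v pi pv el)))

  between-otherLeg : ∀ v i → 0 < v → v ≤ N → ¬ SameLeg i v → between v (end v) i ≡ 0
  between-otherLeg v i pv vN n = vanish (v ≤? i) (i ≤? end v)
    where
    vanish : Dec (v ≤ i) → Dec (i ≤ end v) → between v (end v) i ≡ 0
    vanish (no  vi) _        = between-before v (end v) i vi
    vanish (yes vi) (no  ie) = between-after v (end v) i ie
    vanish (yes vi) (yes ie) = ⊥-elim (n (beyond⇒SameLeg v i pv vN vi ie))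

  depth-< : ∀ v i → i ≤ N → SameLeg i v → i < v → depth i < depth v
  depth-< v i iN (pi , pv , el) lt = subst (λ z → depth i < v ∸ z) el
    (∸-monoˡ-< lt (<⇒≤ (start<label i pi iN)))

  depth-≤ : ∀ v i → SameLeg i v → v ≤ i → depth v ≤ depth i
  depth-≤ v i (pi , pv , el) le = subst (λ z → depth v ≤ i ∸ z) (sym el) (∸-monoˡ-≤ (start v) le)

  -- Moving from the inner neighbour p of v to v brings every vertex beyond v
  -- one step closer and every other vertex one step further:
  --   δ i v + 2·[i beyond v] = δ i p + 1.
  -- First for p the centre (depth v = 1) ...
  stepFromCentre : ∀ v i → 0 < v → v ≤ N → depth v ≡ 1 → i ≤ N →
    δ i v + 2 * between v (end v) i ≡ δ i 0 + 1
  stepFromCentre v i pv vN d1 iN = go (SameLeg? i v) (v ≤? i)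
    where
    open ≡-Reasoning
    go : Dec (SameLeg i v) → Dec (v ≤ i) → δ i v + 2 * between v (end v) i ≡ δ i 0 + 1
    go (yes s) (yes vi) = begin
      δ i v + 2 * between v (end v) i  ≡⟨ cong₂ _+_ (δ-same s) (cong (2 *_) (between-in v (end v) i vi (SameLeg⇒≤end v i iN s))) ⟩
      ∣ depth i - depth v ∣ + 2 * 1     ≡⟨ cong (λ z → ∣ depth i - z ∣ + 2 * 1) d1 ⟩
      ∣ depth i - 1 ∣ + 2 * 1           ≡⟨ ∣a-1+b∣-beyond (depth i) 0 (depth-pos i (proj₁ s) iN) ⟩
      ∣ depth i - 0 ∣ + 1               ≡⟨ cong (_+ 1) (trans (∣-∣-identityʳ (depth i)) (sym (δ-centreʳ i))) ⟩
      δ i 0 + 1                         ∎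
    go (yes s) (no vi) = ⊥-elim (<-irrefl refl (<-≤-trans (depth-pos i (proj₁ s) iN)
                            (≤-pred (≤-trans (depth-< v i iN s (≰⇒> vi)) (≤-reflexive d1)))))
    go (no n) _ = begin
      δ i v + 2 * between v (end v) i  ≡⟨ cong₂ _+_ (δ-other n) (cong (2 *_) (between-otherLeg v i pv vN n)) ⟩
      depth i + depth v + 2 * 0         ≡⟨ cong (λ z → depth i + z + 0) d1 ⟩
      depth i + 1 + 0                   ≡⟨ +-identityʳ _ ⟩
      depth i + 1                       ≡⟨ cong (_+ 1) (sym (δ-centreʳ i)) ⟩
      δ i 0 + 1                         ∎

  -- ... and then for p = v − 1 on the same leg (depth v ≥ 2).
  stepFromPred : ∀ v' i → suc v' ≤ N → 2 ≤ depth (suc v') → i ≤ N →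
    δ i (suc v') + 2 * between (suc v') (end (suc v')) i ≡ δ i v' + 1
  stepFromPred v' i vN two iN = go (SameLeg? i v) (v ≤? i)
    where
    v = suc v'
    open InwardStep (inwardStep v' vN two)
    open ≡-Reasoning
    go : Dec (SameLeg i v) → Dec (v ≤ i) → δ i v + 2 * between v (end v) i ≡ δ i v' + 1
    go (yes s) (yes vi) = begin
      δ i v + 2 * between v (end v) i  ≡⟨ cong₂ _+_ (trans (δ-same s) (cong (λ z → ∣ depth i - z ∣) depthStep))
                                                     (cong (2 *_) (between-in v (end v) i vi (SameLeg⇒≤end v i iN s))) ⟩
      ∣ depth i - suc (depth v') ∣ + 2 * 1  ≡⟨ ∣a-1+b∣-beyond (depth i) (depth v') (≤-trans (≤-reflexive (sym depthStep)) (depth-≤ v i s vi)) ⟩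
      ∣ depth i - depth v' ∣ + 1        ≡⟨ cong (_+ 1) (sym (δ-same (SameLeg-trans s (SameLeg-sym sameLeg)))) ⟩
      δ i v' + 1                        ∎
    go (yes s) (no vi) = begin
      δ i v + 2 * between v (end v) i  ≡⟨ cong₂ _+_ (trans (δ-same s) (cong (λ z → ∣ depth i - z ∣) depthStep))
                                                     (cong (2 *_) (between-before v (end v) i vi)) ⟩
      ∣ depth i - suc (depth v') ∣ + 2 * 0  ≡⟨ ∣a-1+b∣-before (depth i) (depth v') (≤-pred (≤-trans (depth-< v i iN s (≰⇒> vi)) (≤-reflexive depthStep))) ⟩
      ∣ depth i - depth v' ∣ + 1        ≡⟨ cong (_+ 1) (sym (δ-same (SameLeg-trans s (SameLeg-sym sameLeg)))) ⟩
      δ i v' + 1                        ∎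
    go (no n) _ = begin
      δ i v + 2 * between v (end v) i  ≡⟨ cong₂ _+_ (trans (δ-other n) (cong (depth i +_) depthStep))
                                                     (cong (2 *_) (between-otherLeg v i (s≤s z≤n) vN n)) ⟩
      depth i + suc (depth v') + 0      ≡⟨ trans (+-identityʳ _) (trans (+-suc (depth i) (depth v')) (+-comm 1 _)) ⟩
      depth i + depth v' + 1            ≡⟨ cong (_+ 1) (sym (δ-other (λ s → n (SameLeg-trans s sameLeg)))) ⟩
      δ i v' + 1                        ∎

  -- Summing the pointwise step over all vertices: the transmission drops by
  -- twice the number of vertices beyond v and grows by N + 1.
  Trδ-step : ∀ v p → (∀ i → i ≤ N → δ i v + 2 * between v (end v) i ≡ δ i p + 1) → end v ≤ N →
    Trδ v + 2 * (suc (end v) ∸ v) ≡ Trδ p + suc N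
  Trδ-step v p pointwise eN = begin
    Trδ v + 2 * (suc (end v) ∸ v)
      ≡⟨ cong (λ z → Trδ v + 2 * z) (sym (trans (countBetween v (end v) (suc N)) (cong (_∸ v) (m≥n⇒m⊓n≡n (s≤s eN))))) ⟩
    Trδ v + 2 * sumBelow (between v (end v)) (suc N)
      ≡⟨ cong (Trδ v +_) (sym (sumBelow-* 2 (between v (end v)) (suc N))) ⟩
    Trδ v + sumBelow (λ i → 2 * between v (end v) i) (suc N)
      ≡⟨ sym (sumBelow-+ (λ i → δ i v) (λ i → 2 * between v (end v) i) (suc N)) ⟩
    sumBelow (λ i → δ i v + 2 * between v (end v) i) (suc N)
      ≡⟨ sumBelow-cong _ _ (suc N) (λ i lt → pointwise i (≤-pred lt)) ⟩
    sumBelow (λ i → δ i p + 1) (suc N)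
      ≡⟨ sumBelow-+ (λ i → δ i p) (λ _ → 1) (suc N) ⟩
    Trδ p + sumBelow (λ _ → 1) (suc N)
      ≡⟨ cong (Trδ p +_) (trans (sumBelow-const 1 (suc N)) (*-identityʳ (suc N))) ⟩
    Trδ p + suc N ∎
    where open ≡-Reasoning

  countBeyond : ∀ v → 0 < v → v ≤ N → suc (end v) ∸ v ≡ suc (legLen v) ∸ depth v
  countBeyond v pv vN = trans (cong₂ _∸_ (sym (+-suc (start v) (legLen v))) (sym (start+depth v pv vN)))
                              ([m+n]∸[m+o]≡n∸o (start v) (suc (legLen v)) (depth v))

  formula-byDepth : ∀ d v → 0 < v → v ≤ N → depth v ≡ suc d →
    Trδ v + depth v * (2 * legLen v) ≡ Trδ 0 + depth v * (N + depth v)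
  formula-byDepth zero v pv vN d1 = subst (λ z → Trδ v + z * (2 * legLen v) ≡ Trδ 0 + z * (N + z)) (sym d1)
    (formula-base (Trδ v) (Trδ 0) N (legLen v)
      (trans (cong (λ z → Trδ v + 2 * z) (sym (trans (countBeyond v pv vN) (cong (suc (legLen v) ∸_) d1))))
             (Trδ-step v 0 (λ i iN → stepFromCentre v i pv vN d1 iN) (end≤N v pv vN))))
  formula-byDepth (suc d) (suc v') pv vN dv = subst (λ z → Trδ v + z * (2 * legLen v) ≡ Trδ 0 + z * (N + z)) (sym depthStep)
    (subst (λ z → Trδ v + suc x * (2 * z) ≡ Trδ 0 + suc x * (N + suc x)) K≡
      (formula-step (Trδ v) (Trδ v') (Trδ 0) N x r outward IH))
    where
    v = suc v'
    two : 2 ≤ depth v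
    two = ≤-trans (s≤s (s≤s z≤n)) (≤-reflexive (sym dv))
    open InwardStep (inwardStep v' vN two)
    pv' : 0 < v'
    pv' = ≤-trans (s≤s z≤n) start<pred
    x = depth v'
    -- r counts the vertices strictly beyond v on its leg.
    r = proj₁ (m≤n⇒∃[o]m+o≡n (depth≤legLen v pv vN))
    K≡ : suc x + r ≡ legLen v
    K≡ = trans (cong (_+ r) (sym depthStep)) (proj₂ (m≤n⇒∃[o]m+o≡n (depth≤legLen v pv vN)))
    beyondCount : suc (end v) ∸ v ≡ suc r
    beyondCount = trans (countBeyond v pv vN) (trans (cong₂ _∸_ (cong suc (sym K≡)) depthStep)
                    (trans (cong (_∸ x) (sym (+-suc x r))) (m+n∸m≡n x (suc r))))
    outward : Trδ v + 2 * suc r ≡ Trδ v' + suc N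
    outward = trans (cong (λ z → Trδ v + 2 * z) (sym beyondCount))
                    (Trδ-step v v' (λ i iN → stepFromPred v' i vN two iN) (end≤N v pv vN))
    IH : Trδ v' + x * (2 * (suc x + r)) ≡ Trδ 0 + x * (N + x)
    IH = trans (cong (λ z → Trδ v' + x * (2 * z))
                 (trans K≡ (sym (sameStart⇒sameLength ks 0 v' v pv' pv sameStart))))
               (formula-byDepth d v' pv' (≤-trans (n≤1+n v') vN) (suc-injective (trans (sym depthStep) dv)))

  transmission-formula : ∀ v → 0 < v → v ≤ N → Trδ v + depth v * (2 * legLen v) ≡ Trδ 0 + depth v * (N + depth v)
  transmission-formula v pv vN =
    formula-byDepth (pred (depth v)) v pv vN (sym (suc-pred (depth v) {{>-nonZero (depth-pos v pv vN)}}))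

-- By the transmission formula, vertices at depths x and y on legs of lengths
-- K and K' have equal transmission exactly when Collision N x K y K' holds.
Collision : ℕ → ℕ → ℕ → ℕ → ℕ → Set
Collision N x K y K' = x * (2 * K) + y * (N + y) ≡ x * (N + x) + y * (2 * K')

collision-sym : ∀ {N x K y K'} → Collision N x K y K' → Collision N y K' x K
collision-sym {N} {x} {K} {y} {K'} E =
  trans (+-comm (y * (2 * K')) (x * (N + x))) (trans (sym E) (+-comm (x * (2 * K)) (y * (N + y))))

collision-from-formulas : ∀ S₁ S₂ Z a b c d → S₁ ≡ S₂ → S₁ + a ≡ Z + b → S₂ + c ≡ Z + d → a + d ≡ b + c
collision-from-formulas S₁ S₂ Z a b c d refl h₁ h₂ = +-cancelˡ-≡ (S₁ + Z) _ _
  (trans (regroup₁ S₁ Z a d) (trans (cong₂ _+_ h₁ (sym h₂)) (regroup₂ S₁ Z b c)))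
  where
  regroup₁ : ∀ S Z a d → S + Z + (a + d) ≡ (S + a) + (Z + d)
  regroup₁ = solve-∀
  regroup₂ : ∀ S Z b c → (Z + b) + (S + c) ≡ S + Z + (b + c)
  regroup₂ = solve-∀

*-monoʳ-<′ : ∀ x m n → 0 < x → m < n → x * m < x * n
*-monoʳ-<′ (suc x) m n _ lt = +-mono-<-≤ lt (*-monoʳ-≤ x (<⇒≤ lt))

x[m+x]-injective : ∀ m x y → x * (m + x) ≡ y * (m + y) → x ≡ y
x[m+x]-injective m x y e with <-cmp x y
... | tri≈ _ eq _ = eq
... | tri< lt _ _ = ⊥-elim (<-irrefl e (*-mono-< lt (+-monoʳ-< m lt)))
... | tri> _ _ gt = ⊥-elim (<-irrefl (sym e) (*-mono-< gt (+-monoʳ-< m gt)))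

collision-sameLength : ∀ K m x y → Collision (2 * K + m) x K y K → x ≡ y
collision-sameLength K m x y E = x[m+x]-injective m x y (sym (+-cancelˡ-≡ (x * (2 * K) + y * (2 * K)) _ _
  (trans (regroup₁ K m x y) (trans E (regroup₂ K m x y)))))
  where
  regroup₁ : ∀ K m x y → x * (2 * K) + y * (2 * K) + y * (m + y) ≡ x * (2 * K) + y * ((2 * K + m) + y)
  regroup₁ = solve-∀
  regroup₂ : ∀ K m x y → x * ((2 * K + m) + x) + y * (2 * K) ≡ x * (2 * K) + y * (2 * K) + x * (m + x)
  regroup₂ = solve-∀

-- If the vertex y on the longer leg is not deeper than x, the
-- right side exceeds the left; otherwise the left exceeds the right.  In
-- both cases the gap is an explicit positive polynomial.
collision-shortLegs : ∀ A e w N x y → N ≡ 2 * (1 + e) * A + 2 * e + 2 + w → 1 ≤ y → x ≤ A →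
  ¬ Collision N x A y (A + suc e)
collision-shortLegs A e w N x (suc y) refl (s≤s z≤n) x≤A E with suc y ≤? x
... | yes y≤x with m≤n⇒∃[o]m+o≡n y≤x
...   | t , refl = m+1+n≢m _ (trans (sym (shallowGap A e w y t)) (sym E))
  where
  shallowGap : ∀ A e w y t →
    (suc y + t) * ((2 * (1 + e) * A + 2 * e + 2 + w) + (suc y + t)) + suc y * (2 * (A + suc e))
    ≡ ((suc y + t) * (2 * A) + suc y * ((2 * (1 + e) * A + 2 * e + 2 + w) + suc y))
      + suc (2 * e * suc y + t * (2 * e * A + 2 * e + 2 + w) + 2 * t * suc y + t * t + 2 * y + 1)
  shallowGap = solve-∀
collision-shortLegs A e w N x (suc y) refl (s≤s z≤n) x≤A E | no y≰x
  with m≤n⇒∃[o]m+o≡n (≰⇒> y≰x) | m≤n⇒∃[o]m+o≡n x≤A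
... | t , refl | q , refl = m+1+n≢m _ (trans (sym (deepGap x q e w t)) E)
  where
  deepGap : ∀ x q e w t →
    x * (2 * (x + q)) + (suc x + t) * ((2 * (1 + e) * (x + q) + 2 * e + 2 + w) + (suc x + t))
    ≡ (x * ((2 * (1 + e) * (x + q) + 2 * e + 2 + w) + x) + (suc x + t) * (2 * ((x + q) + suc e)))
      + suc (2 * e * q + 2 * e * q * t + 2 * e * t * x + 2 * t + t * w + 2 * t * x + t * t + w)
  deepGap = solve-∀

legsT : ℕ → ℕ → List ℕ
legsT a k = consecutive a k ++ (bigLeg a k ∷ [])

twice-sum-consecutive : ∀ a n → 2 * sum (map (λ j → a + j) (upTo n)) + n ≡ n * (2 * a + n)
twice-sum-consecutive a zero = refl
twice-sum-consecutive a (suc n) = begin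
  2 * sum (map (a +_) (upTo (suc n))) + suc n
    ≡⟨ cong (λ z → 2 * sum (map (a +_) z) + suc n) (sym (upTo-∷ʳ n)) ⟩
  2 * sum (map (a +_) (upTo n ++ n ∷ [])) + suc n
    ≡⟨ cong (λ z → 2 * sum z + suc n) (map-++ (a +_) (upTo n) (n ∷ [])) ⟩
  2 * sum (map (a +_) (upTo n) ++ a + n ∷ []) + suc n
    ≡⟨ cong (λ z → 2 * z + suc n) (sum-++ (map (a +_) (upTo n)) (a + n ∷ [])) ⟩
  2 * (s + (a + n + 0)) + suc n
    ≡⟨ split s a n ⟩
  2 * s + n + (2 * a + 2 * n + 1)
    ≡⟨ cong (_+ (2 * a + 2 * n + 1)) (twice-sum-consecutive a n) ⟩
  n * (2 * a + n) + (2 * a + 2 * n + 1)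
    ≡⟨ grow a n ⟩
  suc n * (2 * a + suc n) ∎
  where
  open ≡-Reasoning
  s = sum (map (a +_) (upTo n))
  split : ∀ s a n → 2 * (s + (a + n + 0)) + suc n ≡ 2 * s + n + (2 * a + 2 * n + 1)
  split = solve-∀
  grow : ∀ a n → n * (2 * a + n) + (2 * a + 2 * n + 1) ≡ suc n * (2 * a + suc n)
  grow = solve-∀

double-bigLeg : ∀ a k → bigLeg a k + bigLeg a k ≡ (2 * a + k) * (k + 1)
double-bigLeg a k = +-cancelʳ-≡ (suc k) _ _
  (trans (doubling (bigLeg a k)) (trans (twice-sum-consecutive a (suc k)) (shift a k)))
  where
  doubling : ∀ B → B + B + suc k ≡ 2 * B + suc k
  doubling = solve-∀
  shift : ∀ a k → suc k * (2 * a + suc k) ≡ (2 * a + k) * (k + 1) + suc k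
  shift = solve-∀

sum-legsT : ∀ a k → sum (legsT a k) ≡ bigLeg a k + bigLeg a k
sum-legsT a k = trans (sum-++ (consecutive a k) (bigLeg a k ∷ [])) (cong (bigLeg a k +_) (+-identityʳ _))

legT-cases : ∀ a k K → K ∈ legsT a k → (K ≡ bigLeg a k) ⊎ (Σ ℕ λ j → (j ≤ k) × (K ≡ a + j))
legT-cases a k K m with ∈-++⁻ (consecutive a k) m
... | inj₂ (here e) = inj₁ e
... | inj₁ m' with ∈-map⁻ _ m'
... | j , j∈ , e = inj₂ (j , ≤-pred (∈-upTo⁻ j∈) , e)

shortLeg<bigLeg : ∀ a' k' → suc a' + suc k' < bigLeg (suc a') (suc k')
shortLeg<bigLeg a' k' = ≰⇒> λ le → <-irrefl refl (<-≤-trans (≤-<-trans (+-mono-≤ le le) (m<m+n _ (s≤s z≤n)))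
  (≤-reflexive (trans (sym (expand a' k')) (sym (double-bigLeg (suc a') (suc k'))))))
  where
  expand : ∀ a' k' → (2 * suc a' + suc k') * (suc k' + 1)
    ≡ (suc a' + suc k') + (suc a' + suc k') + suc (suc (2 * a' + 2 * a' * k' + 3 * k' + k' * k'))
  expand = solve-∀

ascending-applyUpTo : ∀ (f : ℕ → ℕ) n B → (∀ i j → i < j → f i < f j) → (∀ i → i < n → f i < B) →
  Ascending (applyUpTo f n ++ B ∷ [])
ascending-applyUpTo f zero    B mono bnd = [] , tt
ascending-applyUpTo f (suc n) B mono bnd =
  ++⁺ (applyUpTo⁺₁ (f ∘ suc) n (λ {i} _ → mono 0 (suc i) (s≤s z≤n))) (bnd 0 (s≤s z≤n) ∷ []) ,
  ascending-applyUpTo (f ∘ suc) n B (λ i j lt → mono (suc i) (suc j) (s≤s lt)) (λ i lt → bnd (suc i) (s≤s lt))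

ascending-legsT : ∀ a' k' → Ascending (legsT (suc a') (suc k'))
ascending-legsT a' k' =
  subst (λ z → Ascending (z ++ bigLeg (suc a') (suc k') ∷ [])) (sym (map-upTo (suc a' +_) (suc (suc k'))))
    (ascending-applyUpTo (suc a' +_) (suc (suc k')) (bigLeg (suc a') (suc k')) (λ i j lt → +-monoʳ-< (suc a') lt)
      (λ i lt → ≤-<-trans (+-monoʳ-≤ (suc a') (≤-pred lt)) (shortLeg<bigLeg a' k')))

-- Two short legs a + j < a + j' of T never collide: N = (2a + k)(k + 1) is
-- large enough for collision-shortLegs.
collision-shortLegsT : ∀ a j e r N x y → N ≡ (2 * a + (j + suc e + r)) * ((j + suc e + r) + 1) → 1 ≤ y → x ≤ a + j →
  ¬ Collision N x (a + j) y (a + (j + suc e))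
collision-shortLegsT a j e r N x y N≡ py xA E =
  collision-shortLegs (a + j) e slack N x y (trans N≡ (expand a j e r)) py xA
    (subst (λ z → Collision N x (a + j) y z) (sym (+-assoc a j (suc e))) E)
  where
  slack = 2 * a + 2 * a * j + 2 * a * r + e + 2 * e * r + e * e + j + 2 * j * r + j * j + 3 * r + r * r
  expand : ∀ a j e r → (2 * a + (j + suc e + r)) * ((j + suc e + r) + 1)
    ≡ 2 * (1 + e) * (a + j) + 2 * e + 2 + (2 * a + 2 * a * j + 2 * a * r + e + 2 * e * r + e * e + j + 2 * j * r + j * j + 3 * r + r * r)
  expand = solve-∀

NoSquareInD : ℕ → ℕ → Set
NoSquareInD a k = (d m : ℕ) → InD a k d → d ≡ m * m →
  ¬ ((k * (2 * a + k ∸ 1) + 1 ≤ d) × (d ≤ bigLeg a k * bigLeg a k))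

h+1≡ : ∀ a' k' → hh (suc a') (suc k') + 1 ≡ k' * (2 * suc a' + suc k') + 2 * suc a'
h+1≡ a' k' = m∸n+n≡m (≤-trans (s≤s z≤n) (m≤n+m (2 * suc a') (k' * (2 * suc a' + suc k'))))

lowerEnd≡h+2 : ∀ a' k' → suc k' * (2 * suc a' + suc k' ∸ 1) + 1 ≡ hh (suc a') (suc k') + 1 + 1
lowerEnd≡h+2 a' k' = trans (cong (λ z → suc k' * (z ∸ 1) + 1) (+-suc (2 * suc a') k'))
  (trans (expand a' k') (cong (_+ 1) (sym (h+1≡ a' k'))))
  where
  expand : ∀ a' k' → suc k' * (2 * suc a' + k') + 1 ≡ k' * (2 * suc a' + suc k') + 2 * suc a' + 1
  expand = solve-∀

-- The element of D with index p = y and i = r + 1 equals y(2B + y) − 2y(a + j)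
-- when j + r = k; this is what a long/short collision produces.
D-element-identity : ∀ a j r h y' T → h + 1 + (2 * a + (j + r)) ≡ (j + r) * (2 * a + (j + r)) + 2 * a →
  T ≡ (2 * a + (j + r)) * ((j + r) + 1) →
  suc y' * h + suc y' * y' + 2 * suc y' * suc r + suc y' * (2 * (a + j)) ≡ suc y' * (T + suc y')
D-element-identity a j r h y' T h≡ T≡ = +-cancelʳ-≡ (suc y' * (1 + (2 * a + (j + r)))) _ _ (begin
  y * h + y * y' + 2 * y * suc r + y * (2 * (a + j)) + y * (1 + (2 * a + (j + r)))
    ≡⟨ collect a j r h y' ⟩
  y * (h + 1 + (2 * a + (j + r))) + y * y' + 2 * y * suc r + y * (2 * (a + j))
    ≡⟨ cong (λ z → y * z + y * y' + 2 * y * suc r + y * (2 * (a + j))) h≡ ⟩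
  y * ((j + r) * (2 * a + (j + r)) + 2 * a) + y * y' + 2 * y * suc r + y * (2 * (a + j))
    ≡⟨ redistribute a j r y' ⟩
  y * ((2 * a + (j + r)) * ((j + r) + 1) + y) + y * (1 + (2 * a + (j + r)))
    ≡⟨ cong (λ z → y * (z + y) + y * (1 + (2 * a + (j + r)))) (sym T≡) ⟩
  y * (T + y) + y * (1 + (2 * a + (j + r))) ∎)
  where
  open ≡-Reasoning
  y = suc y'
  collect : ∀ a j r h y' → suc y' * h + suc y' * y' + 2 * suc y' * suc r + suc y' * (2 * (a + j)) + suc y' * (1 + (2 * a + (j + r)))
    ≡ suc y' * (h + 1 + (2 * a + (j + r))) + suc y' * y' + 2 * suc y' * suc r + suc y' * (2 * (a + j))
  collect = solve-∀
  redistribute : ∀ a j r y' → suc y' * ((j + r) * (2 * a + (j + r)) + 2 * a) + suc y' * y' + 2 * suc y' * suc r + suc y' * (2 * (a + j))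
    ≡ suc y' * ((2 * a + (j + r)) * ((j + r) + 1) + suc y') + suc y' * (1 + (2 * a + (j + r)))
  redistribute = solve-∀

D-element≥ : ∀ h y' r → suc y' * h + suc y' * y' + 2 * suc y' * suc r
  ≡ h + 1 + 1 + (y' * h + y' * y' + 3 * y' + 2 * y' * r + 2 * r)
D-element≥ = solve-∀

index-admissible : ∀ a k p r j → j + r ≡ k → p ≤ a + j → suc r ≤ iBound a k p
index-admissible a k p r j e le with p ≤ᵇ a
... | true  = ≤-trans (≤-reflexive (+-comm 1 r)) (+-monoˡ-≤ 1 (≤-trans (m≤n+m r j) (≤-reflexive e)))
... | false = ≤-trans (≤-reflexive r+1≡) (∸-monoʳ-≤ (k + 1) p∸a≤j)
  where
  p∸a≤j : p ∸ a ≤ j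
  p∸a≤j = ≤-trans (∸-monoˡ-≤ a le) (≤-reflexive (m+n∸m≡n a j))
  r+1≡ : suc r ≡ k + 1 ∸ j
  r+1≡ = sym (trans (cong (λ z → z + 1 ∸ j) (sym e))
           (trans (cong (_∸ j) (+-assoc j r 1)) (trans (m+n∸m≡n j (r + 1)) (+-comm r 1))))

-- A collision between the long leg (depth x) and the short leg a + j (depth
-- y ≥ 1) makes d = x² an element of D in the forbidden interval.
collision-longShort : ∀ a' k' → NoSquareInD (suc a') (suc k') → ∀ j r x y →
  let a = suc a' ; k = suc k' ; B = bigLeg (suc a') (suc k') in
  j + r ≡ k → 1 ≤ y → y ≤ a + j → x ≤ B → ¬ Collision (B + B) x B y (a + j)
collision-longShort a' k' noSquare j r x (suc y') jr (s≤s z≤n) y≤ x≤B E =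
  noSquare d x d∈D d≡x² (lower , upper)
  where
  a = suc a'
  k = suc k'
  B = bigLeg a k
  y = suc y'
  h = hh a k
  d = y * h + y * (y ∸ 1) + 2 * y * suc r
  expand : ∀ x B → x * (B + B + x) ≡ x * (2 * B) + x * x
  expand = solve-∀
  square-side : y * (B + B + y) ≡ x * x + y * (2 * (a + j))
  square-side = +-cancelˡ-≡ (x * (2 * B)) _ _ (trans E (trans (cong (_+ y * (2 * (a + j))) (expand x B))
    (+-assoc (x * (2 * B)) (x * x) _)))
  h≡ : h + 1 + (2 * a + (j + r)) ≡ (j + r) * (2 * a + (j + r)) + 2 * a
  h≡ = subst (λ z → h + 1 + (2 * a + z) ≡ z * (2 * a + z) + 2 * a) (sym jr)
    (trans (cong (_+ (2 * a + k)) (h+1≡ a' k')) (grow a k'))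
    where
    grow : ∀ a k' → k' * (2 * a + suc k') + 2 * a + (2 * a + suc k') ≡ suc k' * (2 * a + suc k') + 2 * a
    grow = solve-∀
  d≡x² : d ≡ x * x
  d≡x² = +-cancelʳ-≡ (y * (2 * (a + j))) _ _ (trans
    (D-element-identity a j r h y' (B + B) h≡ (trans (double-bigLeg a k) (cong (λ z → (2 * a + z) * (z + 1)) (sym jr))))
    square-side)
  d∈D : InD a k d
  d∈D = y , suc r , s≤s z≤n , ≤-trans y≤ (+-monoʳ-≤ a (≤-trans (m≤m+n j r) (≤-reflexive jr))) ,
        s≤s z≤n , index-admissible a k y r j jr y≤ , refl
  lower : k * (2 * a + k ∸ 1) + 1 ≤ d
  lower = ≤-trans (≤-reflexive (lowerEnd≡h+2 a' k')) (≤-trans (m≤m+n (h + 1 + 1) _) (≤-reflexive (sym (D-element≥ h y' r))))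
  upper : d ≤ B * B
  upper = ≤-trans (≤-reflexive d≡x²) (*-mono-≤ x≤B x≤B)

module TreeT (a' k' : ℕ) where
  a k B : ℕ
  a = suc a'
  k = suc k'
  B = bigLeg a k

  open Star (legsT a k)
  open Transmission (legsT a k)

  N≡2B : N ≡ B + B
  N≡2B = sum-legsT a k

  legLen-cases : ∀ w → 0 < w → w ≤ N → (legLen w ≡ B) ⊎ (Σ ℕ λ j → (j ≤ k) × (legLen w ≡ a + j))
  legLen-cases w pw wN = legT-cases a k (legLen w) (legLength∈ (legsT a k) 0 w pw wN)

  2legLen≤N : ∀ w → 0 < w → w ≤ N → 2 * legLen w ≤ N
  2legLen≤N w pw wN = ≤-trans (≤-reflexive (cong (legLen w +_) (+-identityʳ (legLen w))))
    (≤-trans (+-mono-≤ K≤B K≤B) (≤-reflexive (sym N≡2B)))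
    where
    K≤B : legLen w ≤ B
    K≤B with legLen-cases w pw wN
    ... | inj₁ e = ≤-reflexive e
    ... | inj₂ (j , j≤k , e) = ≤-trans (≤-reflexive e) (≤-trans (+-monoʳ-≤ a j≤k) (<⇒≤ (shortLeg<bigLeg a' k')))

  -- The centre has strictly smaller transmission than any other vertex,
  -- since 2K ≤ N < N + x.
  centre-unique : ∀ v → 0 < v → v ≤ N → Trδ 0 ≡ Trδ v → ⊥
  centre-unique v pv vN e = <-irrefl same (*-monoʳ-<′ (depth v) _ _ (depth-pos v pv vN)
      (≤-<-trans (2legLen≤N v pv vN) (m<m+n N (depth-pos v pv vN))))
    where
    same : depth v * (2 * legLen v) ≡ depth v * (N + depth v)
    same = +-cancelˡ-≡ (Trδ v) _ _ (trans (transmission-formula v pv vN) (cong (_+ depth v * (N + depth v)) e))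

  collision : ∀ u v → 0 < u → u ≤ N → 0 < v → v ≤ N → Trδ u ≡ Trδ v →
    Collision N (depth u) (legLen u) (depth v) (legLen v)
  collision u v pu uN pv vN e =
    collision-from-formulas _ _ _ _ _ _ _ e (transmission-formula u pu uN) (transmission-formula v pv vN)

  collision-onLeg : ∀ u v → 0 < u → u ≤ N → 0 < v → v ≤ N → start u ≡ start v →
    Collision N (depth u) (legLen u) (depth v) (legLen v) → u ≡ v
  collision-onLeg u v pu uN pv vN su≡sv E =
    trans (sym (start+depth u pu uN)) (trans (cong₂ _+_ su≡sv equalDepth) (start+depth v pv vN))
    where
    K = legLen u
    m = proj₁ (m≤n⇒∃[o]m+o≡n (2legLen≤N u pu uN))
    N≡ : N ≡ 2 * K + m
    N≡ = sym (proj₂ (m≤n⇒∃[o]m+o≡n (2legLen≤N u pu uN)))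
    equalDepth : depth u ≡ depth v
    equalDepth = collision-sameLength K m (depth u) (depth v)
      (subst (λ n → Collision n (depth u) K (depth v) K) N≡
        (subst (Collision N (depth u) K (depth v)) (sym (sameStart⇒sameLength (legsT a k) 0 u v pu pv su≡sv)) E))

  N≡split : ∀ j e r → j + suc e + r ≡ k → N ≡ (2 * a + (j + suc e + r)) * ((j + suc e + r) + 1)
  N≡split j e r jer = trans N≡2B (trans (double-bigLeg a k) (cong (λ z → (2 * a + z) * (z + 1)) (sym jer)))

  collision-shortT : ∀ j j' x y → j < j' → j' ≤ k → 1 ≤ y → x ≤ a + j → ¬ Collision N x (a + j) y (a + j')
  collision-shortT j j' x y j<j' j'≤k py x≤ E with m≤n⇒∃[o]m+o≡n j<j' | m≤n⇒∃[o]m+o≡n j'≤k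
  ... | e , refl | r , jr = collision-shortLegsT a j e r N x y (N≡split j e r (trans (cong (_+ r) (+-suc j e)) jr)) py x≤
    (subst (λ z → Collision N x (a + j) y (a + z)) (sym (+-suc j e)) E)

  collision-longShortT : NoSquareInD a k → ∀ u v → 0 < u → u ≤ N → 0 < v → v ≤ N →
    legLen u ≡ B → ∀ {j} → j ≤ k → legLen v ≡ a + j → ¬ Collision N (depth u) (legLen u) (depth v) (legLen v)
  collision-longShortT noSquare u v pu uN pv vN Ku {j} j≤k Kv E with m≤n⇒∃[o]m+o≡n j≤k
  ... | r , jr = collision-longShort a' k' noSquare j r (depth u) (depth v) jr (depth-pos v pv vN)
    (≤-trans (depth≤legLen v pv vN) (≤-reflexive Kv)) (≤-trans (depth≤legLen u pu uN) (≤-reflexive Ku))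
    (subst (λ n → Collision n (depth u) B (depth v) (a + j)) N≡2B
      (subst₂ (λ K K' → Collision N (depth u) K (depth v) K') Ku Kv E))

  -- Vertices on different legs never collide (all legs have different lengths).
  collision-offLeg : NoSquareInD a k → ∀ u v → 0 < u → u ≤ N → 0 < v → v ≤ N → ¬ (start u ≡ start v) →
    ¬ Collision N (depth u) (legLen u) (depth v) (legLen v)
  collision-offLeg noSquare u v pu uN pv vN su≢sv E with legLen-cases u pu uN | legLen-cases v pv vN
  ... | inj₁ Ku | inj₁ Kv = su≢sv (sameLength⇒sameStart (legsT a k) 0 u v (ascending-legsT a' k') pu uN pv vN
                              (trans Ku (sym Kv)))
  ... | inj₁ Ku | inj₂ (j , j≤k , Kv) = collision-longShortT noSquare u v pu uN pv vN Ku j≤k Kv E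
  ... | inj₂ (j , j≤k , Ku) | inj₁ Kv = collision-longShortT noSquare v u pv vN pu uN Kv j≤k Ku
                                          (collision-sym {N} {depth u} {legLen u} {depth v} {legLen v} E)
  ... | inj₂ (j , j≤k , Ku) | inj₂ (j' , j'≤k , Kv) with <-cmp j j'
  ...   | tri≈ _ j≡j' _ = su≢sv (sameLength⇒sameStart (legsT a k) 0 u v (ascending-legsT a' k') pu uN pv vN
                            (trans Ku (trans (cong (a +_) j≡j') (sym Kv))))
  ...   | tri< j<j' _ _ = collision-shortT j j' (depth u) (depth v) j<j' j'≤k (depth-pos v pv vN)
                            (≤-trans (depth≤legLen u pu uN) (≤-reflexive Ku))
                            (subst₂ (λ K K' → Collision N (depth u) K (depth v) K') Ku Kv E)
  ...   | tri> _ _ j'<j = collision-shortT j' j (depth v) (depth u) j'<j j≤k (depth-pos u pu uN)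
                            (≤-trans (depth≤legLen v pv vN) (≤-reflexive Kv))
                            (collision-sym {N} {depth u} {a + j} {depth v} {a + j'}
                              (subst₂ (λ K K' → Collision N (depth u) K (depth v) K') Ku Kv E))

  Trδ-injective : NoSquareInD a k → ∀ u v → u ≤ N → v ≤ N → Trδ u ≡ Trδ v → u ≡ v
  Trδ-injective noSquare zero    zero    _  _  _ = refl
  Trδ-injective noSquare zero    (suc v) _  vN e = ⊥-elim (centre-unique (suc v) (s≤s z≤n) vN e)
  Trδ-injective noSquare (suc u) zero    uN _  e = ⊥-elim (centre-unique (suc u) (s≤s z≤n) uN (sym e))
  Trδ-injective noSquare (suc u) (suc v) uN vN e with start (suc u) ≟ start (suc v)
  ... | yes same = collision-onLeg (suc u) (suc v) (s≤s z≤n) uN (s≤s z≤n) vN same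
                     (collision (suc u) (suc v) (s≤s z≤n) uN (s≤s z≤n) vN e)
  ... | no other = ⊥-elim (collision-offLeg noSquare (suc u) (suc v) (s≤s z≤n) uN (s≤s z≤n) vN other
                     (collision (suc u) (suc v) (s≤s z≤n) uN (s≤s z≤n) vN e))

theorem3p3 : (a k : ℕ) → 1 ≤ a → 1 ≤ k →
    ((d m : ℕ) → InD a k d → d ≡ m * m →
      ¬ ((k * (2 * a + k ∸ 1) + 1 ≤ d) × (d ≤ bigLeg a k * bigLeg a k))) →
    TransmissionIrregular (T a k)
theorem3p3 zero     k        ()        _         _
theorem3p3 (suc a') zero     _         ()        _
theorem3p3 (suc a') (suc k') _         _         noSquare {u} {v} Tru≡Trv =
  toℕ-injective (Trδ-injective noSquare (toℕ u) (toℕ v) (label≤N u) (label≤N v)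
    (trans (sym (Tr≡Trδ u)) (trans Tru≡Trv (Tr≡Trδ v))))
  where
  open TreeT a' k'
  open Star (legsT (suc a') (suc k')) using (label≤N)
  open Transmission (legsT (suc a') (suc k')) using (Tr≡Trδ)
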